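{- Let $p$ be an odd prime and $\mathbb{F}_p=\mathbb{Z}/p\mathbb{Z}$. For $t\in\mathbb{F}_p$, let $N_p(t)$ denote the number of pairs $(x,y)\in(\mathbb{F}_p^*)^2$ satisfying $x+\frac{1}{x}+y+\frac{1}{y}=t$. Then for $t\in\mathbb{F}_p$, $N_p(t)$ is odd if and only if $t\equiv \pm 4\pmod p$.
   Context: $\mathbb{F}_p^*$ denotes the nonzero elements of $\mathbb{F}_p$, and $\frac1x$ denotes the multiplicative inverse of $x$ in $\mathbb{F}_p$. -}

module Defs where

open import Data.Nat using (ℕ; zero; suc; _+_; _*_; _∸_; _%_; _≡ᵇ_; NonZero)
open import Data.Nat.Primality using (Prime)
open import Data.Bool using (Bool; _∧_)
open import Data.List using (List; []; _∷_; upTo; filterᵇ; length; cartesianProduct; drop)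
open import Data.Product using (_×_; _,_)

-- Elements of F_p = ℤ/pℤ are represented by their canonical residues 0,1,…,p-1 (naturals).
-- Arithmetic in F_p: ordinary ℕ arithmetic followed by reduction mod p.

Fpˣ : (p : ℕ) → List ℕ
Fpˣ p = drop 1 (upTo p)

-- Multiplicative inverse 1/x in F_p: the element u ∈ F_p^* with x·u ≡ 1 (mod p)
-- (found by search; it exists and is unique when p is prime and x ∈ F_p^*).
firstOr : ℕ → List ℕ → ℕ
firstOr d []      = d
firstOr d (u ∷ _) = u

inv : (p : ℕ) .{{_ : NonZero p}} → ℕ → ℕ
inv p x = firstOr 0 (filterᵇ (λ u → ((x * u) % p) ≡ᵇ 1) (Fpˣ p))

sat : (p : ℕ) .{{_ : NonZero p}} → ℕ → ℕ × ℕ → Bool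
sat p t (x , y) = ((x + inv p x + y + inv p y) % p) ≡ᵇ (t % p)

N : (p : ℕ) .{{_ : NonZero p}} → ℕ → ℕ
N p t = length (filterᵇ (sat p t) (cartesianProduct (Fpˣ p) (Fpˣ p)))

{-# OPTIONS --safe #-}
module Submission where

-- The swap (x , y) ↦ (y , x) is an involution of the solution set of
-- x + 1/x + y + 1/y = t, so N_p(t) has the parity of the number of its fixed
-- points, the diagonal solutions 2 (x + 1/x) = t.  These are permuted by
-- x ↦ 1/x, whose only fixed points in F_p^* are ±1, so
-- N_p(t) ≡ [t = 4] + [t = -4] (mod 2); for odd p the two brackets never
-- hold together.

open import Defs
open import Algebra.Properties.CommutativeSemigroup using (x∙yz≈y∙xz)
open import Data.Bool using (Bool; true; false; T; _∧_)
open import Data.Bool.Properties using (∧-identityʳ; ∧-zeroʳ)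
open import Data.Empty using (⊥-elim)
open import Data.List using (List; []; _∷_; _++_; map; filter; filterᵇ; length; cartesianProduct)
open import Data.List.Membership.Propositional using (_∈_)
open import Data.List.Membership.Propositional.Properties
  using (∈-filter⁻; ∈-filter⁺; ∈-applyUpTo⁺; ∈-applyUpTo⁻; ∈-cartesianProduct⁺; ∈-cartesianProduct⁻)
open import Data.List.Properties using (map-++; map-∘; filter-all; filter-accept; filter-reject; length-filter)
open import Data.List.Relation.Unary.All as All using ()
open import Data.List.Relation.Unary.AllPairs using (_∷_)
open import Data.List.Relation.Unary.Any using (here; there)
open import Data.List.Relation.Unary.Unique.Propositional using (Unique)
open import Data.List.Relation.Unary.Unique.Propositional.Properties as Unique
  using (cartesianProduct⁺; drop⁺; upTo⁺)
open import Data.Nat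
open import Data.Nat.Coprimality using (Coprime; coprime-Bézout; coprime-divisor; prime⇒coprime)
open import Data.Nat.DivMod
open import Data.Nat.Divisibility using (_∣_; divides; ∣⇒≤; >⇒∤)
open import Data.Nat.GCD using (module Bézout)
open import Data.Nat.ListAction using (sum)
open import Data.Nat.ListAction.Properties using (sum-++)
open import Data.Nat.Primality using (Prime; euclidsLemma; composite⇒¬prime; composite[4]; composite-∣; ¬prime[1])
open import Data.Nat.Properties
open import Data.Nat.Tactic.RingSolver using (solve-∀)
open import Data.Product using (_×_; _,_; proj₁; proj₂; ∃-syntax; swap)
open import Data.Product.Properties using (≡-dec)
open import Data.Sum using (_⊎_; inj₁; inj₂; [_,_]′)
open import Function using (_∘_)
open import Relation.Binary.Definitions using (DecidableEquality)
open import Relation.Binary.PropositionalEquality hiding ([_])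
open import Relation.Nullary using (Dec; ¬_; yes; no; does; ¬?; contradiction)
open import Relation.Nullary.Decidable using (dec-true; dec-false; map′)
open ≡-Reasoning

𝟙 : Bool → ℕ
𝟙 true  = 1
𝟙 false = 0

∧-does-yes : ∀ {p} {P : Set p} b (p? : Dec P) → P → b ∧ does p? ≡ b
∧-does-yes b p? p = trans (cong (b ∧_) (dec-true p? p)) (∧-identityʳ b)

∧-does-no : ∀ {p} {P : Set p} b (p? : Dec P) → ¬ P → b ∧ does p? ≡ false
∧-does-no b p? ¬p = trans (cong (b ∧_) (dec-false p? ¬p)) (∧-zeroʳ b)

odd-indicator-sum : ∀ {a b} {A : Set a} {B : Set b} (a? : Dec A) (b? : Dec B) → ¬ (A × B) →
                    ((𝟙 (does a?) + 𝟙 (does b?)) % 2 ≡ 1 → A ⊎ B) ×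
                    (A ⊎ B → (𝟙 (does a?) + 𝟙 (does b?)) % 2 ≡ 1)
odd-indicator-sum (yes a) (yes b) ¬a×b = contradiction (a , b) ¬a×b
odd-indicator-sum (yes a) (no _)  _    = (λ _ → inj₁ a) , (λ _ → refl)
odd-indicator-sum (no _)  (yes b) _    = (λ _ → inj₂ b) , (λ _ → refl)
odd-indicator-sum (no ¬a) (no ¬b) _    = (λ ()) , [ ⊥-elim ∘ ¬a , ⊥-elim ∘ ¬b ]′

+-congˡ-% : ∀ k {m n d} .{{_ : NonZero d}} → m % d ≡ n % d → (k + m) % d ≡ (k + n) % d
+-congˡ-% k {m} {n} {d} m≡n = begin
  (k + m) % d             ≡⟨ %-distribˡ-+ k m d ⟩
  (k % d + m % d) % d     ≡⟨ cong (λ r → (k % d + r) % d) m≡n ⟩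
  (k % d + n % d) % d     ≡⟨ %-distribˡ-+ k n d ⟨
  (k + n) % d             ∎

[k+[k+m]]%2≡m%2 : ∀ k m → (k + (k + m)) % 2 ≡ m % 2
[k+[k+m]]%2≡m%2 k m = trans (cong (_% 2) (double k m)) ([m+kn]%n≡m%n m k 2)
  where
  double : ∀ k m → k + (k + m) ≡ m + k * 2
  double = solve-∀

[1+n]*[1+n]≡1+n*[2+n] : ∀ n → (1 + n) * (1 + n) ≡ 1 + n * (2 + n)
[1+n]*[1+n]≡1+n*[2+n] = solve-∀

∣∧<⇒≡0 : ∀ {d m} → d ∣ m → m < d → m ≡ 0
∣∧<⇒≡0 {m = zero}  _   _   = refl
∣∧<⇒≡0 {m = suc _} d∣m m<d = contradiction d∣m (>⇒∤ m<d)

%≡%⇒∣∸ : ∀ {m n d} .{{_ : NonZero d}} → n ≤ m → m % d ≡ n % d → d ∣ m ∸ n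
%≡%⇒∣∸ {m} {n} {d} n≤m m≡n = divides (m / d ∸ n / d) (begin
  m ∸ n                                       ≡⟨ cong₂ _∸_ (m≡m%n+[m/n]*n m d) (m≡m%n+[m/n]*n n d) ⟩
  (m % d + m / d * d) ∸ (n % d + n / d * d)   ≡⟨ cong (λ r → (r + m / d * d) ∸ (n % d + n / d * d)) m≡n ⟩
  (n % d + m / d * d) ∸ (n % d + n / d * d)   ≡⟨ [m+n]∸[m+o]≡n∸o (n % d) _ _ ⟩
  m / d * d ∸ n / d * d                       ≡⟨ *-distribʳ-∸ d (m / d) (n / d) ⟨
  (m / d ∸ n / d) * d                         ∎)

m*[n%d]%d≡m*n%d : ∀ m n d .{{_ : NonZero d}} → m * (n % d) % d ≡ m * n % d
m*[n%d]%d≡m*n%d m n d = begin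
  m * (n % d) % d             ≡⟨ %-distribˡ-* m (n % d) d ⟩
  (m % d) * (n % d % d) % d   ≡⟨ cong (λ r → (m % d) * r % d) (m%n%n≡m%n n d) ⟩
  (m % d) * (n % d) % d       ≡⟨ %-distribˡ-* m n d ⟨
  m * n % d                   ∎

*-cancelˡ-% : ∀ {d x u v} .{{_ : NonZero d}} → Coprime d x → u < d → v < d →
              x * u % d ≡ x * v % d → u ≡ v
*-cancelˡ-% {d} {x} {u} {v} d⊥x u<d v<d xu≡xv =
  [ (λ u≤v → sym (cancel u≤v v<d (sym xu≡xv))) , (λ v≤u → cancel v≤u u<d xu≡xv) ]′ (≤-total u v)
  where
  cancel : ∀ {u v} → u ≤ v → v < d → x * v % d ≡ x * u % d → v ≡ u
  cancel {u} {v} u≤v v<d xv≡xu = begin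
    v          ≡⟨ m∸n+n≡m u≤v ⟨
    v ∸ u + u  ≡⟨ cong (_+ u) (∣∧<⇒≡0 d∣v∸u (≤-<-trans (m∸n≤m v u) v<d)) ⟩
    u          ∎
    where
    d∣v∸u : d ∣ v ∸ u
    d∣v∸u = coprime-divisor d⊥x
              (subst (d ∣_) (sym (*-distribˡ-∸ x v u)) (%≡%⇒∣∸ (*-monoʳ-≤ x u≤v) xv≡xu))

count : ∀ {a} {A : Set a} → (A → Bool) → List A → ℕ
count P = sum ∘ map (𝟙 ∘ P)

module _ {a} {A : Set a} where

  length-filterᵇ : ∀ (P : A → Bool) xs → length (filterᵇ P xs) ≡ count P xs
  length-filterᵇ P []       = refl
  length-filterᵇ P (x ∷ xs) with P x
  ... | true  = cong suc (length-filterᵇ P xs)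
  ... | false = length-filterᵇ P xs

  count-++ : ∀ (P : A → Bool) xs ys → count P (xs ++ ys) ≡ count P xs + count P ys
  count-++ P xs ys = trans (cong sum (map-++ (𝟙 ∘ P) xs ys)) (sum-++ (map (𝟙 ∘ P) xs) _)

  count-map : ∀ {b} {B : Set b} (P : A → Bool) (g : B → A) xs → count P (map g xs) ≡ count (P ∘ g) xs
  count-map P g xs = cong sum (sym (map-∘ xs))

  count-none : ∀ (P : A → Bool) {xs} → (∀ {x} → x ∈ xs → P x ≡ false) → count P xs ≡ 0
  count-none P {[]}     _    = refl
  count-none P {x ∷ xs} none rewrite none (here refl) = count-none P (none ∘ there)

module _ {a} {A : Set a} (_≟_ : DecidableEquality A) where

  remove : A → List A → List A
  remove c = filter (λ x → ¬? (x ≟ c))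

  ∈-remove⁻ : ∀ {c x} xs → x ∈ remove c xs → x ∈ xs × x ≢ c
  ∈-remove⁻ {c} xs = ∈-filter⁻ (λ y → ¬? (y ≟ c)) {xs = xs}

  ∈-remove⁺ : ∀ {c x xs} → x ∈ xs → x ≢ c → x ∈ remove c xs
  ∈-remove⁺ {c} = ∈-filter⁺ (λ y → ¬? (y ≟ c))

  remove-unique : ∀ c {xs} → Unique xs → Unique (remove c xs)
  remove-unique c = Unique.filter⁺ (λ y → ¬? (y ≟ c))

  length-remove : ∀ c xs → length (remove c xs) ≤ length xs
  length-remove c = length-filter (λ y → ¬? (y ≟ c))

  count-remove : ∀ (P : A → Bool) {c xs} → Unique xs → c ∈ xs →
                 count P xs ≡ 𝟙 (P c) + count P (remove c xs)
  count-remove P {xs = x ∷ xs} (x∉xs ∷ _) (here refl) =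
    cong (λ ys → 𝟙 (P x) + count P ys) (sym (begin
      remove x (x ∷ xs) ≡⟨ filter-reject (λ y → ¬? (y ≟ x)) (λ x≢x → x≢x refl) ⟩
      remove x xs       ≡⟨ filter-all (λ y → ¬? (y ≟ x)) (All.map ≢-sym x∉xs) ⟩
      xs                ∎))
  count-remove P {c} {x ∷ xs} (x∉xs ∷ xs!) (there c∈xs) = begin
    𝟙 (P x) + count P xs
      ≡⟨ cong (𝟙 (P x) +_) (count-remove P xs! c∈xs) ⟩
    𝟙 (P x) + (𝟙 (P c) + count P (remove c xs))
      ≡⟨ x∙yz≈y∙xz +-commutativeSemigroup (𝟙 (P x)) (𝟙 (P c)) _ ⟩
    𝟙 (P c) + count P (x ∷ remove c xs)
      ≡⟨ cong (λ ys → 𝟙 (P c) + count P ys) keep-x ⟨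
    𝟙 (P c) + count P (remove c (x ∷ xs)) ∎
    where
    keep-x : remove c (x ∷ xs) ≡ x ∷ remove c xs
    keep-x = filter-accept (λ y → ¬? (y ≟ c)) (All.lookup x∉xs c∈xs)

  count-single-candidate : ∀ (P : A → Bool) {c xs} → Unique xs → c ∈ xs →
                           (∀ {x} → x ∈ xs → x ≢ c → P x ≡ false) → count P xs ≡ 𝟙 (P c)
  count-single-candidate P {c} {xs} xs! c∈xs others = begin
    count P xs                         ≡⟨ count-remove P xs! c∈xs ⟩
    𝟙 (P c) + count P (remove c xs)    ≡⟨ cong (𝟙 (P c) +_) (count-none P others′) ⟩
    𝟙 (P c) + 0                        ≡⟨ +-identityʳ _ ⟩
    𝟙 (P c)                            ∎
    where
    others′ : ∀ {x} → x ∈ remove c xs → P x ≡ false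
    others′ x∈ = let x∈xs , x≢c = ∈-remove⁻ xs x∈ in others x∈xs x≢c

  count-two-candidates : ∀ (P : A → Bool) {c d xs} → Unique xs → c ≢ d → c ∈ xs → d ∈ xs →
                         (∀ {x} → x ∈ xs → x ≢ c → x ≢ d → P x ≡ false) →
                         count P xs ≡ 𝟙 (P c) + 𝟙 (P d)
  count-two-candidates P {c} {d} {xs} xs! c≢d c∈xs d∈xs others = begin
    count P xs
      ≡⟨ count-remove P xs! c∈xs ⟩
    𝟙 (P c) + count P (remove c xs)
      ≡⟨ cong (𝟙 (P c) +_) (count-single-candidate P (remove-unique c xs!) d∈rest others′) ⟩
    𝟙 (P c) + 𝟙 (P d) ∎
    where
    d∈rest : d ∈ remove c xs
    d∈rest = ∈-remove⁺ d∈xs (≢-sym c≢d)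
    others′ : ∀ {x} → x ∈ remove c xs → x ≢ d → P x ≡ false
    others′ x∈ = let x∈xs , x≢c = ∈-remove⁻ xs x∈ in others x∈xs x≢c

record InvolutionOn {a} {A : Set a} (f : A → A) (xs : List A) : Set a where
  field
    closed     : ∀ {x} → x ∈ xs → f x ∈ xs
    involutive : ∀ {x} → x ∈ xs → f (f x) ≡ x

  fx≡y⇒x≡fy : ∀ {x y} → x ∈ xs → f x ≡ y → x ≡ f y
  fx≡y⇒x≡fy x∈xs fx≡y = trans (sym (involutive x∈xs)) (cong f fx≡y)

module _ {a} {A : Set a} (_≟_ : DecidableEquality A) {f : A → A} where

  involutionOn-∷ : ∀ {x xs} → Unique (x ∷ xs) → InvolutionOn f (x ∷ xs) → f x ≡ x → InvolutionOn f xs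
  involutionOn-∷ {x} {xs} (x∉xs ∷ _) inv fx≡x = record
    { closed     = closed′
    ; involutive = involutive ∘ there
    }
    where
    open InvolutionOn inv
    closed′ : ∀ {y} → y ∈ xs → f y ∈ xs
    closed′ y∈xs with closed (there y∈xs)
    ... | here fy≡x  = contradiction (trans (fx≡y⇒x≡fy (there y∈xs) fy≡x) fx≡x) (≢-sym (All.lookup x∉xs y∈xs))
    ... | there fy∈xs = fy∈xs

  involutionOn-remove : ∀ {x xs} → Unique (x ∷ xs) → InvolutionOn f (x ∷ xs) →
                        InvolutionOn f (remove _≟_ (f x) xs)
  involutionOn-remove {x} {xs} (x∉xs ∷ _) inv = record
    { closed     = closed′
    ; involutive = involutive ∘ there ∘ proj₁ ∘ ∈-remove⁻ _≟_ xs
    }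
    where
    open InvolutionOn inv
    closed′ : ∀ {y} → y ∈ remove _≟_ (f x) xs → f y ∈ remove _≟_ (f x) xs
    closed′ {y} y∈ with ∈-remove⁻ _≟_ xs y∈
    ... | y∈xs , y≢fx with closed (there y∈xs)
    ...   | here fy≡x   = contradiction (fx≡y⇒x≡fy (there y∈xs) fy≡x) y≢fx
    ...   | there fy∈xs = ∈-remove⁺ _≟_ fy∈xs fy≢fx
      where
      fy≢fx : f y ≢ f x
      fy≢fx fy≡fx = All.lookup x∉xs y∈xs (sym (trans (fx≡y⇒x≡fy (there y∈xs) fy≡fx) (involutive (here refl))))

  count-involution-%2 : ∀ (P : A → Bool) {xs} → Unique xs → InvolutionOn f xs →
                        (∀ {x} → x ∈ xs → P (f x) ≡ P x) →
                        count P xs % 2 ≡ count (λ x → P x ∧ does (f x ≟ x)) xs % 2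
  count-involution-%2 P {xs} = go (length xs) ≤-refl
    where
    Q : A → Bool
    Q x = P x ∧ does (f x ≟ x)

    -- Induction on length: a non-fixed x leaves together with its partner f x.
    go : ∀ n {xs} → length xs ≤ n → Unique xs → InvolutionOn f xs →
         (∀ {x} → x ∈ xs → P (f x) ≡ P x) → count P xs % 2 ≡ count Q xs % 2
    go _       {[]}     _         _                   _   _   = refl
    go (suc n) {x ∷ xs} (s≤s len) x∷xs!@(_ ∷ xs!) inv P∘f≡P with f x ≟ x
    ... | yes fx≡x = begin
      (𝟙 (P x) + count P xs) % 2
        ≡⟨ +-congˡ-% (𝟙 (P x)) (go n len xs! (involutionOn-∷ x∷xs! inv fx≡x) (P∘f≡P ∘ there)) ⟩
      (𝟙 (P x) + count Q xs) % 2
        ≡⟨ cong (λ b → (𝟙 b + count Q xs) % 2) (∧-identityʳ (P x)) ⟨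
      (𝟙 (P x ∧ true) + count Q xs) % 2 ∎
    ... | no fx≢x = begin
      (𝟙 (P x) + count P xs) % 2
        ≡⟨ cong (λ m → (𝟙 (P x) + m) % 2) (count-remove _≟_ P xs! fx∈xs) ⟩
      (𝟙 (P x) + (𝟙 (P (f x)) + count P rest)) % 2
        ≡⟨ cong (λ b → (𝟙 (P x) + (𝟙 b + count P rest)) % 2) (P∘f≡P (here refl)) ⟩
      (𝟙 (P x) + (𝟙 (P x) + count P rest)) % 2
        ≡⟨ [k+[k+m]]%2≡m%2 (𝟙 (P x)) (count P rest) ⟩
      count P rest % 2
        ≡⟨ go n rest≤n (remove-unique _≟_ (f x) xs!) (involutionOn-remove x∷xs! inv)
              (P∘f≡P ∘ there ∘ proj₁ ∘ ∈-remove⁻ _≟_ xs) ⟩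
      count Q rest % 2
        ≡⟨ cong (_% 2) count-Q ⟨
      (𝟙 (P x ∧ false) + count Q xs) % 2 ∎
      where
      open InvolutionOn inv
      rest : List A
      rest = remove _≟_ (f x) xs
      rest≤n : length rest ≤ n
      rest≤n = ≤-trans (length-remove _≟_ (f x) xs) len
      fx∈xs : f x ∈ xs
      fx∈xs with closed (here refl)
      ... | here fx≡x   = contradiction fx≡x fx≢x
      ... | there fx∈xs = fx∈xs
      count-Q : 𝟙 (P x ∧ false) + count Q xs ≡ count Q rest
      count-Q = begin
        𝟙 (P x ∧ false) + count Q xs
          ≡⟨ cong (λ b → 𝟙 b + count Q xs) (∧-zeroʳ (P x)) ⟩
        count Q xs
          ≡⟨ count-remove _≟_ Q xs! fx∈xs ⟩
        𝟙 (Q (f x)) + count Q rest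
          ≡⟨ cong (λ b → 𝟙 b + count Q rest) (∧-does-no (P (f x)) (f (f x) ≟ f x) ffx≢fx) ⟩
        count Q rest ∎
        where
        ffx≢fx : f (f x) ≢ f x
        ffx≢fx ffx≡fx = fx≢x (sym (trans (sym (involutive (here refl))) ffx≡fx))

swap-involutionOn : ∀ {a} {A : Set a} (xs : List A) → InvolutionOn swap (cartesianProduct xs xs)
swap-involutionOn xs = record
  { closed     = λ z∈ → let x∈xs , y∈xs = ∈-cartesianProduct⁻ xs xs z∈ in ∈-cartesianProduct⁺ y∈xs x∈xs
  ; involutive = λ _ → refl
  }

module _ {a} {A : Set a} (_≟_ : DecidableEquality A) where

  count-swap-fixed : ∀ (P : A × A → Bool) {xs} → Unique xs →
                     count (λ z → P z ∧ does (≡-dec _≟_ _≟_ (swap z) z)) (cartesianProduct xs xs) ≡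
                     count (λ x → P (x , x)) xs
  count-swap-fixed P {xs} xs! = rows xs (λ y∈ → y∈)
    where
    _≟²_ : DecidableEquality (A × A)
    _≟²_ = ≡-dec _≟_ _≟_

    Q : A × A → Bool
    Q z = P z ∧ does (swap z ≟² z)

    row : ∀ {x} → x ∈ xs → count (λ y → Q (x , y)) xs ≡ 𝟙 (P (x , x))
    row {x} x∈xs = begin
      count (λ y → Q (x , y)) xs ≡⟨ count-single-candidate _≟_ (λ y → Q (x , y)) xs! x∈xs off-diagonal ⟩
      𝟙 (Q (x , x))              ≡⟨ cong 𝟙 (∧-does-yes (P (x , x)) ((x , x) ≟² (x , x)) refl) ⟩
      𝟙 (P (x , x))              ∎
      where
      off-diagonal : ∀ {y} → y ∈ xs → y ≢ x → Q (x , y) ≡ false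
      off-diagonal {y} _ y≢x = ∧-does-no (P (x , y)) ((y , x) ≟² (x , y)) (y≢x ∘ cong proj₁)

    rows : ∀ ys → (∀ {y} → y ∈ ys → y ∈ xs) → count Q (cartesianProduct ys xs) ≡ count (λ x → P (x , x)) ys
    rows []       _     = refl
    rows (y ∷ ys) ys⊆xs = begin
      count Q (map (y ,_) xs ++ cartesianProduct ys xs)
        ≡⟨ count-++ Q (map (y ,_) xs) _ ⟩
      count Q (map (y ,_) xs) + count Q (cartesianProduct ys xs)
        ≡⟨ cong₂ _+_ (count-map Q (y ,_) xs) (rows ys (ys⊆xs ∘ there)) ⟩
      count (λ z → Q (y , z)) xs + count (λ x → P (x , x)) ys
        ≡⟨ cong (_+ count (λ x → P (x , x)) ys) (row (ys⊆xs (here refl))) ⟩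
      𝟙 (P (y , y)) + count (λ x → P (x , x)) ys ∎

∈-Fpˣ⁻ : ∀ {n x} → x ∈ Fpˣ n → 0 < x × x < n
∈-Fpˣ⁻ {suc n} x∈ with ∈-applyUpTo⁻ suc x∈
... | i , i<n , refl = s≤s z≤n , s≤s i<n

∈-Fpˣ⁺ : ∀ {n x} → 0 < x → x < n → x ∈ Fpˣ n
∈-Fpˣ⁺ {suc n} {suc i} _ (s≤s i<n) = ∈-applyUpTo⁺ suc i<n

Fpˣ-unique : ∀ n → Unique (Fpˣ n)
Fpˣ-unique n = drop⁺ 1 (upTo⁺ n)

firstOr-filterᵇ : ∀ (B : ℕ → Bool) d {u xs} → u ∈ xs → T (B u) →
                  firstOr d (filterᵇ B xs) ∈ xs × T (B (firstOr d (filterᵇ B xs)))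
firstOr-filterᵇ B d {xs = x ∷ xs} u∈ Bu with B x in Bx
... | true = here refl , subst T (sym Bx) _
firstOr-filterᵇ B d {xs = x ∷ xs} (here refl) Bu | false = ⊥-elim (subst T Bx Bu)
firstOr-filterᵇ B d {xs = x ∷ xs} (there u∈) Bu | false =
  let first∈ , B-first = firstOr-filterᵇ B d u∈ Bu in there first∈ , B-first

sat-swap : ∀ p .{{_ : NonZero p}} t z → sat p t (swap z) ≡ sat p t z
sat-swap p t (x , y) = cong (λ s → s % p ≡ᵇ t % p) (swap-halves x (inv p x) y (inv p y))
  where
  swap-halves : ∀ a b c d → c + d + a + b ≡ a + b + c + d
  swap-halves = solve-∀

4[p-1]≡-4 : ∀ r → (1 + r + (1 + r) + (1 + r) + (1 + r)) % (2 + r) ≡ ((2 + r) ∸ 4 % (2 + r)) % (2 + r)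
4[p-1]≡-4 0 = refl
4[p-1]≡-4 1 = refl
4[p-1]≡-4 2 = refl
4[p-1]≡-4 r@(suc (suc (suc u))) = begin
  (1 + r + (1 + r) + (1 + r) + (1 + r)) % p
    ≡⟨ cong (_% p) (four-times u) ⟩
  (suc u + 3 * p) % p
    ≡⟨ [m+kn]%n≡m%n (suc u) 3 p ⟩
  suc u % p
    ≡⟨ cong (λ m → (p ∸ m) % p) (m<n⇒m%n≡m {n = p} (s≤s (s≤s (s≤s (s≤s (s≤s z≤n)))))) ⟨
  (p ∸ 4 % p) % p ∎
  where
  p : ℕ
  p = 2 + r
  four-times : ∀ u → 4 + u + (4 + u) + (4 + u) + (4 + u) ≡ suc u + 3 * (5 + u)
  four-times = solve-∀

4≢-4 : ∀ {r} → Prime (2 + r) → 2 + r ≢ 2 → 4 % (2 + r) ≢ ((2 + r) ∸ 4 % (2 + r)) % (2 + r)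
4≢-4 {0}                   _       p≢2 = contradiction refl p≢2
4≢-4 {1}                   _       _   = λ ()
4≢-4 {2}                   p-prime _   = contradiction p-prime (composite⇒¬prime composite[4])
4≢-4 {r@(suc (suc (suc u)))} p-prime _ 4≡-4 =
  contradiction (subst Prime (cong (4 +_) 1+u≡4) p-prime)
                (composite⇒¬prime (composite-∣ composite[4] (divides 2 refl)))
  where
  p : ℕ
  p = 2 + r
  4%p≡4 : 4 % p ≡ 4
  4%p≡4 = m<n⇒m%n≡m {n = p} (s≤s (s≤s (s≤s (s≤s (s≤s z≤n)))))
  1+u≡4 : suc u ≡ 4
  1+u≡4 = begin
    suc u            ≡⟨ m<n⇒m%n≡m {n = p} (s≤s (s≤s (m≤n+m u 3))) ⟨
    suc u % p        ≡⟨ cong (λ m → (p ∸ m) % p) 4%p≡4 ⟨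
    (p ∸ 4 % p) % p  ≡⟨ 4≡-4 ⟨
    4 % p            ≡⟨ 4%p≡4 ⟩
    4                ∎

module PrimeField {r : ℕ} (p-prime : Prime (2 + r)) where

  p p-1 : ℕ
  p   = 2 + r
  p-1 = 1 + r

  F : List ℕ
  F = Fpˣ p

  ∈F⁻ : ∀ {x} → x ∈ F → 0 < x × x < p
  ∈F⁻ = ∈-Fpˣ⁻ {p}

  1%p≡1 : 1 % p ≡ 1
  1%p≡1 = m<n⇒m%n≡m {n = p} (s≤s (s≤s z≤n))

  1∈F : 1 ∈ F
  1∈F = ∈-Fpˣ⁺ (s≤s z≤n) (s≤s (s≤s z≤n))

  p-1∈F : p-1 ∈ F
  p-1∈F = ∈-Fpˣ⁺ (s≤s z≤n) ≤-refl

  ∈F⇒coprime : ∀ {x} → x ∈ F → Coprime p x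
  ∈F⇒coprime x∈F = let 0<x , x<p = ∈F⁻ x∈F in prime⇒coprime p-prime {{>-nonZero 0<x}} x<p

  inverse∈F : ∀ {x u} → u < p → x * u % p ≡ 1 → u ∈ F
  inverse∈F {x} {zero}  _   x0≡1 = contradiction (trans (cong (_% p) (sym (*-zeroʳ x))) x0≡1) λ ()
  inverse∈F {u = suc _} u<p _    = ∈-Fpˣ⁺ (s≤s z≤n) u<p

  %-inverse : ∀ {x} → x ∈ F → ∃[ u ] u < p × x * u % p ≡ 1
  %-inverse {x} x∈F with coprime-Bézout (∈F⇒coprime x∈F)
  ... | Bézout.-+ a b 1+ap≡bx = b % p , m%n<n b p , (begin
    x * (b % p) % p  ≡⟨ m*[n%d]%d≡m*n%d x b p ⟩
    x * b % p        ≡⟨ cong (_% p) (trans (*-comm x b) (sym 1+ap≡bx)) ⟩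
    (1 + a * p) % p  ≡⟨ [m+kn]%n≡m%n 1 a p ⟩
    1 % p            ≡⟨ 1%p≡1 ⟩
    1                ∎)
  -- Here b x ≡ -1, so (p - 1) b is the inverse.
  ... | Bézout.+- a b 1+bx≡ap = p-1 * b % p , m%n<n (p-1 * b) p , (begin
    x * (p-1 * b % p) % p      ≡⟨ m*[n%d]%d≡m*n%d x (p-1 * b) p ⟩
    x * (p-1 * b) % p          ≡⟨ [m+n]%n≡m%n (x * (p-1 * b)) p ⟨
    (x * (p-1 * b) + p) % p    ≡⟨ cong (_% p) (negate x b r) ⟩
    (1 + p-1 * (1 + b * x)) % p ≡⟨ cong (λ m → (1 + p-1 * m) % p) 1+bx≡ap ⟩
    (1 + p-1 * (a * p)) % p    ≡⟨ cong (_% p) (reassociate a r) ⟩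
    (1 + p-1 * a * p) % p      ≡⟨ [m+kn]%n≡m%n 1 (p-1 * a) p ⟩
    1 % p                      ≡⟨ 1%p≡1 ⟩
    1                          ∎)
    where
    negate : ∀ x b r → x * ((1 + r) * b) + (2 + r) ≡ 1 + (1 + r) * (1 + b * x)
    negate = solve-∀
    reassociate : ∀ a r → 1 + (1 + r) * (a * (2 + r)) ≡ 1 + (1 + r) * a * (2 + r)
    reassociate = solve-∀

  inv-correct : ∀ {x} → x ∈ F → inv p x ∈ F × x * inv p x % p ≡ 1
  inv-correct {x} x∈F =
    let u , u<p , xu≡1    = %-inverse x∈F
        inv∈F , xinv≡ᵇ1 = firstOr-filterᵇ (λ v → x * v % p ≡ᵇ 1) 0 (inverse∈F {x} u<p xu≡1) (≡⇒≡ᵇ _ _ xu≡1)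
    in inv∈F , ≡ᵇ⇒≡ _ _ xinv≡ᵇ1

  inv∈F : ∀ {x} → x ∈ F → inv p x ∈ F
  inv∈F = proj₁ ∘ inv-correct

  inv-unique : ∀ {x u} → x ∈ F → u ∈ F → x * u % p ≡ 1 → inv p x ≡ u
  inv-unique x∈F u∈F xu≡1 =
    *-cancelˡ-% (∈F⇒coprime x∈F) (proj₂ (∈F⁻ (inv∈F x∈F))) (proj₂ (∈F⁻ u∈F))
      (trans (proj₂ (inv-correct x∈F)) (sym xu≡1))

  inv-involutive : ∀ {x} → x ∈ F → inv p (inv p x) ≡ x
  inv-involutive {x} x∈F =
    inv-unique (inv∈F x∈F) x∈F (trans (cong (_% p) (*-comm (inv p x) x)) (proj₂ (inv-correct x∈F)))

  inv-involutionOn : InvolutionOn (inv p) F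
  inv-involutionOn = record { closed = inv∈F ; involutive = inv-involutive }

  inv-1 : inv p 1 ≡ 1
  inv-1 = inv-unique 1∈F 1∈F 1%p≡1

  inv-p-1 : inv p p-1 ≡ p-1
  inv-p-1 = inv-unique p-1∈F p-1∈F (begin
    p-1 * p-1 % p      ≡⟨ cong (_% p) ([1+n]*[1+n]≡1+n*[2+n] r) ⟩
    (1 + r * p) % p    ≡⟨ [m+kn]%n≡m%n 1 r p ⟩
    1 % p              ≡⟨ 1%p≡1 ⟩
    1                  ∎)

  -- x² ≡ 1 gives p ∣ (x - 1)(x + 1).
  inv-fixed : ∀ {x} → x ∈ F → inv p x ≡ x → x ≡ 1 ⊎ x ≡ p-1
  inv-fixed {zero}  x∈F _       = contradiction (proj₁ (∈F⁻ x∈F)) (<-irrefl refl)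
  inv-fixed {suc z} x∈F inv≡x with euclidsLemma z (2 + z) p-prime p∣z[2+z]
    where
    x²≡1 : suc z * suc z % p ≡ 1 % p
    x²≡1 = trans (subst (λ u → suc z * u % p ≡ 1) inv≡x (proj₂ (inv-correct x∈F))) (sym 1%p≡1)
    p∣z[2+z] : p ∣ z * (2 + z)
    p∣z[2+z] = subst (p ∣_) (cong (_∸ 1) ([1+n]*[1+n]≡1+n*[2+n] z)) (%≡%⇒∣∸ (s≤s z≤n) x²≡1)
  ... | inj₁ p∣z   = inj₁ (cong suc (∣∧<⇒≡0 p∣z (<-trans (n<1+n z) (proj₂ (∈F⁻ x∈F)))))
  ... | inj₂ p∣2+z = inj₂ (suc-injective (≤-antisym (proj₂ (∈F⁻ x∈F)) (∣⇒≤ p∣2+z)))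

  sat-inv-diagonal : ∀ t {x} → x ∈ F → sat p t (inv p x , inv p x) ≡ sat p t (x , x)
  sat-inv-diagonal t {x} x∈F = cong (λ s → s % p ≡ᵇ t % p) (begin
    inv p x + inv p (inv p x) + inv p x + inv p (inv p x)
      ≡⟨ cong (λ y → inv p x + y + inv p x + y) (inv-involutive x∈F) ⟩
    inv p x + x + inv p x + x
      ≡⟨ swap-pairs (inv p x) x ⟩
    x + inv p x + x + inv p x ∎)
    where
    swap-pairs : ∀ a b → a + b + a + b ≡ b + a + b + a
    swap-pairs = solve-∀

  sat-1 : ∀ t → sat p t (1 , 1) ≡ (4 % p ≡ᵇ t % p)
  sat-1 t = cong (λ i → (1 + i + 1 + i) % p ≡ᵇ t % p) inv-1

  sat-p-1 : ∀ t → sat p t (p-1 , p-1) ≡ ((p ∸ 4 % p) % p ≡ᵇ t % p)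
  sat-p-1 t = trans (cong (λ i → (p-1 + i + p-1 + i) % p ≡ᵇ t % p) inv-p-1) (cong (_≡ᵇ t % p) (4[p-1]≡-4 r))

  N-parity : p ≢ 2 → ∀ t → N p t % 2 ≡ (𝟙 (sat p t (1 , 1)) + 𝟙 (sat p t (p-1 , p-1))) % 2
  N-parity p≢2 t = begin
    N p t % 2
      ≡⟨ cong (_% 2) (length-filterᵇ (sat p t) F²) ⟩
    count (sat p t) F² % 2
      ≡⟨ count-involution-%2 _≟²_ (sat p t) (cartesianProduct⁺ F! F!) (swap-involutionOn F)
            (λ {z} _ → sat-swap p t z) ⟩
    count (λ z → sat p t z ∧ does (swap z ≟² z)) F² % 2
      ≡⟨ cong (_% 2) (count-swap-fixed _≟_ (sat p t) F!) ⟩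
    count diagonal F % 2
      ≡⟨ count-involution-%2 _≟_ diagonal F! inv-involutionOn (sat-inv-diagonal t) ⟩
    count (λ x → diagonal x ∧ does (inv p x ≟ x)) F % 2
      ≡⟨ cong (_% 2) (count-two-candidates _≟_ _ F! 1≢p-1 1∈F p-1∈F off-±1) ⟩
    (𝟙 (diagonal 1 ∧ does (inv p 1 ≟ 1)) + 𝟙 (diagonal p-1 ∧ does (inv p p-1 ≟ p-1))) % 2
      ≡⟨ cong₂ (λ b c → (𝟙 b + 𝟙 c) % 2) (∧-does-yes (diagonal 1) (inv p 1 ≟ 1) inv-1)
            (∧-does-yes (diagonal p-1) (inv p p-1 ≟ p-1) inv-p-1) ⟩
    (𝟙 (diagonal 1) + 𝟙 (diagonal p-1)) % 2 ∎
    where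
    F² : List (ℕ × ℕ)
    F² = cartesianProduct F F
    F! : Unique F
    F! = Fpˣ-unique p
    _≟²_ : DecidableEquality (ℕ × ℕ)
    _≟²_ = ≡-dec _≟_ _≟_
    diagonal : ℕ → Bool
    diagonal x = sat p t (x , x)
    1≢p-1 : 1 ≢ p-1
    1≢p-1 1≡p-1 = p≢2 (sym (cong suc 1≡p-1))
    off-±1 : ∀ {x} → x ∈ F → x ≢ 1 → x ≢ p-1 → diagonal x ∧ does (inv p x ≟ x) ≡ false
    off-±1 {x} x∈F x≢1 x≢p-1 = ∧-does-no (diagonal x) (inv p x ≟ x) ([ x≢1 , x≢p-1 ]′ ∘ inv-fixed x∈F)

mainTheorem4 : (p : ℕ) .{{_ : NonZero p}} → Prime p → p ≢ 2 → (t : ℕ) → t < p → ((N p t % 2 ≡ 1 → (t ≡ 4 % p ⊎ t ≡ (p ∸ 4 % p) % p)) × ((t ≡ 4 % p ⊎ t ≡ (p ∸ 4 % p) % p) → N p t % 2 ≡ 1))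
mainTheorem4 (suc (suc r)) p-prime p≢2 t t<p =
  -- map′ sym sym decides t ≡ α by the same Boolean α ≡ᵇ t that sat computes.
  subst (λ n → (n ≡ 1 → t≡±4) × (t≡±4 → n ≡ 1)) (sym N≡[t=4]+[t=-4])
    (odd-indicator-sum (map′ sym sym (4 % p ≟ t)) (map′ sym sym ((p ∸ 4 % p) % p ≟ t))
      (λ (t≡4 , t≡-4) → 4≢-4 p-prime p≢2 (trans (sym t≡4) t≡-4)))
  where
  open PrimeField p-prime
  t≡±4 : Set
  t≡±4 = t ≡ 4 % p ⊎ t ≡ (p ∸ 4 % p) % p
  N≡[t=4]+[t=-4] : N p t % 2 ≡ (𝟙 (4 % p ≡ᵇ t) + 𝟙 ((p ∸ 4 % p) % p ≡ᵇ t)) % 2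
  N≡[t=4]+[t=-4] = begin
    N p t % 2
      ≡⟨ N-parity p≢2 t ⟩
    (𝟙 (sat p t (1 , 1)) + 𝟙 (sat p t (p-1 , p-1))) % 2
      ≡⟨ cong₂ (λ b c → (𝟙 b + 𝟙 c) % 2) (sat-1 t) (sat-p-1 t) ⟩
    (𝟙 (4 % p ≡ᵇ t % p) + 𝟙 ((p ∸ 4 % p) % p ≡ᵇ t % p)) % 2
      ≡⟨ cong (λ s → (𝟙 (4 % p ≡ᵇ s) + 𝟙 ((p ∸ 4 % p) % p ≡ᵇ s)) % 2) (m<n⇒m%n≡m t<p) ⟩
    (𝟙 (4 % p ≡ᵇ t) + 𝟙 ((p ∸ 4 % p) % p ≡ᵇ t)) % 2 ∎
mainTheorem4 (suc zero) p-prime = contradiction p-prime ¬prime[1]
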